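{- Let $q\ge5$ be prime, $q^*=(-1)^{(q-1)/2}q$ and $u_q(j)=(3^j-q^*(-1)^j)/4$. Let $n\ge2$ and $m$ be integers with $n\le 2^m$. Then $u_q(1),\ldots,u_q(n)$ are pairwise incongruent modulo $2^m$. -}

module Defs where

open import Data.Nat as ℕ using (ℕ)
open import Data.Nat.DivMod as ℕD using ()
open import Data.Integer using (ℤ; +_; -_; _-_; _*_; _^_)
open import Data.Integer.DivMod using (_/ℕ_)

neg1^ : ℕ → ℤ
neg1^ k = (- (+ 1)) ^ k

qStar : ℕ → ℤ
qStar q = neg1^ ((q ℕ.∸ 1) ℕD./ 2) * (+ q)

-- u_q(j) = (3^j - q* (-1)^j) / 4   (exact division when q is an odd prime)
u : ℕ → ℕ → ℤ
u q j = ((+ 3) ^ j - qStar q * neg1^ j) /ℕ 4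

{-# OPTIONS --safe #-}

-- Let w j = 4 u_q(j) = 3^j - q* (-1)^j; since q is odd, q* ≡ 1 (mod 4), and
-- 2^m ∣ u_q(i) - u_q(j) means 2^(m+2) ∣ w i - w j, where m ≥ 1 because n ≥ 2.
-- If i - j is odd then w i - w j ≡ ±4 (mod 8), which is impossible.  If
-- i - j = 2k then w i - w j = 3^j (9^k - 1), and since 9^k - 1 has 2-adic
-- valuation 3 + v₂(k), 2^(m-1) divides k; as 2k < i ≤ 2^m this forces k = 0.

module Submission where

open import Defs
open import Data.Nat using (ℕ; _≤_; _^_)
open import Data.Nat.Primality using (Prime)
open import Data.Integer using (_-_; +_)
open import Data.Integer.Divisibility using (_∣_)
open import Relation.Binary.PropositionalEquality using (_≡_)
open import Relation.Nullary using (¬_)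

open import Data.Nat as ℕ using (zero; suc; z≤n; s≤s; _<_; NonZero)
import Data.Nat.Properties as ℕP
open import Data.Nat.Divisibility as ℕD using () renaming (_∣_ to _∣ℕ_)
open import Data.Nat.DivMod using (_/_; m*n/n≡m)
open import Data.Nat.Primality using (prime⇒irreducible)
open import Data.Integer using (ℤ; _+_; _*_; -_; ∣_∣) renaming (_^_ to _^ℤ_)
import Data.Integer.Properties as ℤP
open import Data.Integer.DivMod using (_/ℕ_; _%ℕ_; a≡a%ℕn+[a/ℕn]*n; n%ℕd<d)
open import Data.Integer.Divisibility.Signed
  using (∣ᵤ⇒∣; ∣⇒∣ᵤ; ∣-refl; ∣-trans; ∣m∣n⇒∣m+n; ∣m∣n⇒∣m-n; ∣m+n∣m⇒∣n; ∣m+n∣n⇒∣m;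
         ∣m⇒∣-m; ∣n⇒∣m*n; ∣m⇒∣m*n; *-monoʳ-∣; *-monoˡ-∣; *-cancelˡ-∣)
  renaming (_∣_ to _∣ₛ_; divides to dividesₛ)
open import Data.Integer.Tactic.RingSolver using (solve-∀)
import Data.Nat.Tactic.RingSolver as ℕRing
open import Data.Product using (∃; _,_)
open import Data.Sum using (inj₁; inj₂)
open import Relation.Binary.PropositionalEquality
  using (_≢_; refl; sym; trans; cong; cong₂; subst; subst₂; module ≡-Reasoning)
open import Relation.Nullary using (contradiction)

open ≡-Reasoning

data Parity : ℕ → Set where
  even : ∀ k → Parity (2 ℕ.* k)
  odd  : ∀ k → Parity (suc (2 ℕ.* k))

parity : ∀ n → Parity n
parity zero = even 0
parity (suc n) with parity n
... | even k = odd k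
... | odd k  = subst Parity (ℕP.*-suc 2 k) (even (suc k))

m∣n∧n<m⇒n≡0 : ∀ {m n} → m ∣ℕ n → n < m → n ≡ 0
m∣n∧n<m⇒n≡0 {n = zero}  _   _   = refl
m∣n∧n<m⇒n≡0 {n = suc _} m∣n n<m = contradiction (ℕD.∣⇒≤ m∣n) (ℕP.<⇒≱ n<m)

prime≢2⇒odd : ∀ {p} → Prime p → p ≢ 2 → ∃ λ k → p ≡ suc (2 ℕ.* k)
prime≢2⇒odd {p} pr p≢2 with parity p
... | odd k  = k , refl
... | even k with prime⇒irreducible pr (ℕD.m∣m*n k)
...   | inj₁ ()
...   | inj₂ 2≡p = contradiction (sym 2≡p) p≢2

∣⇒[n/ℕd]*d≡n : ∀ {n} d .{{_ : NonZero d}} → + d ∣ₛ n → n /ℕ d * + d ≡ n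
∣⇒[n/ℕd]*d≡n {n} d d∣n = begin
  n /ℕ d * + d                ≡⟨ sym (ℤP.+-identityˡ _) ⟩
  + 0 + n /ℕ d * + d          ≡⟨ cong (λ r → + r + n /ℕ d * + d) (sym r≡0) ⟩
  + (n %ℕ d) + n /ℕ d * + d   ≡⟨ sym (a≡a%ℕn+[a/ℕn]*n n d) ⟩
  n                           ∎
  where
  d∣r : + d ∣ₛ + (n %ℕ d)
  d∣r = ∣m+n∣n⇒∣m (subst (+ d ∣ₛ_) (a≡a%ℕn+[a/ℕn]*n n d) d∣n) (∣n⇒∣m*n (n /ℕ d) ∣-refl)
  r≡0 : n %ℕ d ≡ 0
  r≡0 = m∣n∧n<m⇒n≡0 (∣⇒∣ᵤ d∣r) (n%ℕd<d n d)

∣m-n⇒∣m^k-n^k : ∀ {d} m n k → d ∣ₛ m - n → d ∣ₛ m ^ℤ k - n ^ℤ k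
∣m-n⇒∣m^k-n^k m n zero    _     = dividesₛ (+ 0) refl
∣m-n⇒∣m^k-n^k m n (suc k) d∣m-n = subst (_ ∣ₛ_) (telescope m n (m ^ℤ k) (n ^ℤ k))
  (∣m∣n⇒∣m+n (∣n⇒∣m*n m (∣m-n⇒∣m^k-n^k m n k d∣m-n)) (∣m⇒∣m*n (n ^ℤ k) d∣m-n))
  where
  telescope : ∀ m n a b → m * (a - b) + (m - n) * b ≡ m * a - n * b
  telescope = solve-∀

∣m-1⇒∣m^k-1 : ∀ {d} m k → d ∣ₛ m - + 1 → d ∣ₛ m ^ℤ k - + 1
∣m-1⇒∣m^k-1 {d} m k d∣m-1 =
  subst (λ x → d ∣ₛ m ^ℤ k - x) (ℤP.^-zeroˡ k) (∣m-n⇒∣m^k-n^k m (+ 1) k d∣m-1)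

2^k∣m*n⇒2^k∣n : ∀ k {m n} → + 2 ∣ₛ m - + 1 → + (2 ^ k) ∣ₛ m * n → + (2 ^ k) ∣ₛ n
2^k∣m*n⇒2^k∣n zero    _ _ = ∣ᵤ⇒∣ (ℕD.1∣ _)
2^k∣m*n⇒2^k∣n (suc k) {m} {n} m-odd 2^[1+k]∣mn =
  subst (_∣ₛ n) (sym (ℤP.pos-* 2 (2 ^ k))) (halve 2∣n)
  where
  2·2^k∣mn : + 2 * + (2 ^ k) ∣ₛ m * n
  2·2^k∣mn = subst (_∣ₛ m * n) (ℤP.pos-* 2 (2 ^ k)) 2^[1+k]∣mn
  split : ∀ m n → m * n ≡ (m - + 1) * n + n
  split = solve-∀
  2∣n : + 2 ∣ₛ n
  2∣n = ∣m+n∣m⇒∣n (subst (+ 2 ∣ₛ_) (split m n) (∣-trans (∣m⇒∣m*n (+ (2 ^ k)) ∣-refl) 2·2^k∣mn))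
                  (∣m⇒∣m*n n m-odd)
  regroup : ∀ m l → m * (l * + 2) ≡ + 2 * (m * l)
  regroup = solve-∀
  halve : + 2 ∣ₛ n → + 2 * + (2 ^ k) ∣ₛ n
  halve (dividesₛ l n≡l*2) =
    subst (+ 2 * + (2 ^ k) ∣ₛ_) (sym (trans n≡l*2 (ℤP.*-comm l (+ 2))))
      (*-monoʳ-∣ (+ 2) (2^k∣m*n⇒2^k∣n k {m} m-odd (*-cancelˡ-∣ (+ 2) 2·2^k∣2ml)))
    where
    2·2^k∣2ml : + 2 * + (2 ^ k) ∣ₛ + 2 * (m * l)
    2·2^k∣2ml = subst (_ ∣ₛ_) (trans (cong (m *_) n≡l*2) (regroup m l)) 2·2^k∣mn

^-double : ∀ x k → x ^ℤ (2 ℕ.* k) ≡ x ^ℤ k * x ^ℤ k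
^-double x k = begin
  x ^ℤ (2 ℕ.* k)       ≡⟨ cong (x ^ℤ_) (ℕP.*-comm 2 k) ⟩
  x ^ℤ (k ℕ.* 2)       ≡⟨ sym (ℤP.^-*-assoc x k 2) ⟩
  (x ^ℤ k) ^ℤ 2        ≡⟨ cong (x ^ℤ k *_) (ℤP.*-identityʳ (x ^ℤ k)) ⟩
  x ^ℤ k * x ^ℤ k      ∎

2^m∣2^[m+n] : ∀ m n → + (2 ^ m) ∣ₛ + (2 ^ (m ℕ.+ n))
2^m∣2^[m+n] m n = ∣ᵤ⇒∣ (subst (2 ^ m ∣ℕ_) (sym (ℕP.^-distribˡ-+-* 2 m n)) (ℕD.m∣m*n (2 ^ n)))

2n∤n : ∀ n .{{_ : NonZero n}} → ¬ + (2 ℕ.* n) ∣ₛ + n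
2n∤n n@(suc _) 2n∣n = ℕD.>⇒∤ (ℕP.m<m+n n ℕ.z<s) (∣⇒∣ᵤ 2n∣n)

2^[3+k]∣9^d-1⇒2^k∣d : ∀ k d → + (2 ^ (3 ℕ.+ k)) ∣ₛ (+ 9) ^ℤ d - + 1 → 2 ^ k ∣ℕ d
2^[3+k]∣9^d-1⇒2^k∣d zero    d _ = ℕD.1∣ d
2^[3+k]∣9^d-1⇒2^k∣d (suc k) d h with parity d
... | even e = ℕD.*-monoʳ-∣ 2 (2^[3+k]∣9^d-1⇒2^k∣d k e (*-cancelˡ-∣ (+ 2) 2·2^[3+k]∣2[9^e-1]))
  where
  X : ℤ
  X = (+ 9) ^ℤ e
  8∣X-1 : + 8 ∣ₛ X - + 1
  8∣X-1 = ∣m-1⇒∣m^k-1 (+ 9) e ∣-refl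
  A : ℤ
  A = _∣ₛ_.quotient 8∣X-1
  factor : ∀ X → X * X - + 1 ≡ ((X - + 1) + + 2) * (X - + 1)
  factor = solve-∀
  regroup : ∀ A Y → (A * + 8 + + 2) * Y ≡ (+ 1 + A * + 4) * (+ 2 * Y)
  regroup = solve-∀
  shift : ∀ A → (+ 1 + A * + 4) - + 1 ≡ (A * + 2) * + 2
  shift = solve-∀
  9^[2e]-1≡ : (+ 9) ^ℤ (2 ℕ.* e) - + 1 ≡ (+ 1 + A * + 4) * (+ 2 * (X - + 1))
  9^[2e]-1≡ = begin
    (+ 9) ^ℤ (2 ℕ.* e) - + 1        ≡⟨ cong (_- + 1) (^-double (+ 9) e) ⟩
    X * X - + 1                     ≡⟨ factor X ⟩
    ((X - + 1) + + 2) * (X - + 1)   ≡⟨ cong (λ Y → (Y + + 2) * (X - + 1)) (_∣ₛ_.equality 8∣X-1) ⟩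
    (A * + 8 + + 2) * (X - + 1)     ≡⟨ regroup A (X - + 1) ⟩
    (+ 1 + A * + 4) * (+ 2 * (X - + 1)) ∎
  2·2^[3+k]∣2[9^e-1] : + 2 * + (2 ^ (3 ℕ.+ k)) ∣ₛ + 2 * (X - + 1)
  2·2^[3+k]∣2[9^e-1] = subst (_∣ₛ _) (ℤP.pos-* 2 (2 ^ (3 ℕ.+ k)))
    (2^k∣m*n⇒2^k∣n (4 ℕ.+ k) {+ 1 + A * + 4} (dividesₛ (A * + 2) (shift A)) (subst (_ ∣ₛ_) 9^[2e]-1≡ h))
... | odd e = contradiction 16∣8 (2n∤n 8)
  where
  Y : ℤ
  Y = (+ 81) ^ℤ e
  shift : ∀ Y → + 9 * Y - + 1 ≡ + 8 + + 9 * (Y - + 1)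
  shift = solve-∀
  9^d-1≡ : (+ 9) ^ℤ suc (2 ℕ.* e) - + 1 ≡ + 8 + + 9 * (Y - + 1)
  9^d-1≡ = trans (cong (λ Z → + 9 * Z - + 1) (sym (ℤP.^-*-assoc (+ 9) 2 e))) (shift Y)
  16∣9^d-1 : + 16 ∣ₛ + 8 + + 9 * (Y - + 1)
  16∣9^d-1 = subst (_ ∣ₛ_) 9^d-1≡ (∣-trans (2^m∣2^[m+n] 4 k) h)
  16∣8 : + 16 ∣ₛ + 8
  16∣8 = ∣m+n∣n⇒∣m 16∣9^d-1 (∣n⇒∣m*n (+ 9) (∣m-1⇒∣m^k-1 (+ 81) e (dividesₛ (+ 5) refl)))

2∣[-1]^k-1 : ∀ k → + 2 ∣ₛ neg1^ k - + 1
2∣[-1]^k-1 k = ∣m-1⇒∣m^k-1 (- + 1) k (dividesₛ (- + 1) refl)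

4∣[-1]^k[1+2k]-1 : ∀ k → + 4 ∣ₛ neg1^ k * (+ 1 + + 2 * + k) - + 1
4∣[-1]^k[1+2k]-1 zero    = dividesₛ (+ 0) refl
4∣[-1]^k[1+2k]-1 (suc k) = subst (+ 4 ∣ₛ_) (sym (step (neg1^ k) (+ k)))
  (∣m∣n⇒∣m-n (∣m⇒∣-m (4∣[-1]^k[1+2k]-1 k)) (*-monoʳ-∣ (+ 2) (∣m∣n⇒∣m+n (2∣[-1]^k-1 k) ∣-refl)))
  where
  step : ∀ e K → (- + 1 * e) * (+ 1 + + 2 * (+ 1 + K)) - + 1
                 ≡ - (e * (+ 1 + + 2 * K) - + 1) - + 2 * ((e - + 1) + + 2)
  step = solve-∀

4∣q⋆-1 : ∀ {q} → Prime q → q ≢ 2 → + 4 ∣ₛ qStar q - + 1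
4∣q⋆-1 q-prime q≢2 with prime≢2⇒odd q-prime q≢2
... | k , refl = subst (λ x → + 4 ∣ₛ x - + 1) (sym q⋆≡) (4∣[-1]^k[1+2k]-1 k)
  where
  q⋆≡ : qStar (suc (2 ℕ.* k)) ≡ neg1^ k * (+ 1 + + 2 * + k)
  q⋆≡ = cong₂ (λ a b → neg1^ a * b)
          (trans (cong (_/ 2) (ℕP.*-comm 2 k)) (m*n/n≡m k 2))
          (cong (λ x → + 1 + x) (ℤP.pos-* 2 k))

-- u q j is w (qStar q) j /ℕ 4; the argument only uses Q ≡ 1 (mod 4).
w : ℤ → ℕ → ℤ
w Q j = (+ 3) ^ℤ j - Q * neg1^ j

4∣w : ∀ {Q} j → + 4 ∣ₛ Q - + 1 → + 4 ∣ₛ w Q j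
4∣w {Q} j 4∣Q-1 = subst (+ 4 ∣ₛ_) (sym (split ((+ 3) ^ℤ j) Q (neg1^ j)))
  (∣m∣n⇒∣m-n (∣m-n⇒∣m^k-n^k (+ 3) (- + 1) j ∣-refl) (∣m⇒∣m*n (neg1^ j) 4∣Q-1))
  where
  split : ∀ T Q e → T - Q * e ≡ (T - e) - (Q - + 1) * e
  split = solve-∀

2^m∣u-u⇒2^[2+m]∣w-w : ∀ {q} m i j → + 4 ∣ₛ qStar q - + 1 → + (2 ^ m) ∣ u q i - u q j →
                       + (2 ^ (2 ℕ.+ m)) ∣ₛ w (qStar q) i - w (qStar q) j
2^m∣u-u⇒2^[2+m]∣w-w {q} m i j 4∣Q-1 2^m∣ui-uj =
  subst₂ _∣ₛ_ 2^m*4≡2^[2+m] [ui-uj]*4≡wi-wj (*-monoˡ-∣ (+ 4) (∣ᵤ⇒∣ {+ (2 ^ m)} {u q i - u q j} 2^m∣ui-uj))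
  where
  u*4≡w : ∀ j → u q j * + 4 ≡ w (qStar q) j
  u*4≡w j = ∣⇒[n/ℕd]*d≡n 4 (4∣w {qStar q} j 4∣Q-1)
  distrib : ∀ a b → (a - b) * + 4 ≡ a * + 4 - b * + 4
  distrib = solve-∀
  [ui-uj]*4≡wi-wj : (u q i - u q j) * + 4 ≡ w (qStar q) i - w (qStar q) j
  [ui-uj]*4≡wi-wj = trans (distrib (u q i) (u q j)) (cong₂ _-_ (u*4≡w i) (u*4≡w j))
  x*4≡2[2x] : ∀ x → x ℕ.* 4 ≡ 2 ℕ.* (2 ℕ.* x)
  x*4≡2[2x] = ℕRing.solve-∀
  2^m*4≡2^[2+m] : + (2 ^ m) * + 4 ≡ + (2 ^ (2 ℕ.+ m))
  2^m*4≡2^[2+m] = trans (sym (ℤP.pos-* (2 ^ m) 4)) (cong +_ (x*4≡2[2x] (2 ^ m)))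

neg1^-double : ∀ k → neg1^ (2 ℕ.* k) ≡ + 1
neg1^-double k = trans (sym (ℤP.^-*-assoc (- + 1) 2 k)) (ℤP.^-zeroˡ k)

w[j+2k]-w[j]≡3^j[9^k-1] : ∀ Q j k → w Q (j ℕ.+ 2 ℕ.* k) - w Q j ≡ (+ 3) ^ℤ j * ((+ 9) ^ℤ k - + 1)
w[j+2k]-w[j]≡3^j[9^k-1] Q j k = begin
  w Q (j ℕ.+ 2 ℕ.* k) - w Q j
    ≡⟨ cong₂ (λ a b → a - Q * b - w Q j) 3^[j+2k]≡ [-1]^[j+2k]≡ ⟩
  (+ 3) ^ℤ j * (+ 9) ^ℤ k - Q * (neg1^ j * + 1) - w Q j
    ≡⟨ regroup ((+ 3) ^ℤ j) ((+ 9) ^ℤ k) Q (neg1^ j) ⟩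
  (+ 3) ^ℤ j * ((+ 9) ^ℤ k - + 1) ∎
  where
  3^[j+2k]≡ : (+ 3) ^ℤ (j ℕ.+ 2 ℕ.* k) ≡ (+ 3) ^ℤ j * (+ 9) ^ℤ k
  3^[j+2k]≡ = trans (ℤP.^-distribˡ-+-* (+ 3) j (2 ℕ.* k))
                    (cong ((+ 3) ^ℤ j *_) (sym (ℤP.^-*-assoc (+ 3) 2 k)))
  [-1]^[j+2k]≡ : neg1^ (j ℕ.+ 2 ℕ.* k) ≡ neg1^ j * + 1
  [-1]^[j+2k]≡ = trans (ℤP.^-distribˡ-+-* (- + 1) j (2 ℕ.* k)) (cong (neg1^ j *_) (neg1^-double k))
  regroup : ∀ T N Q e → T * N - Q * (e * + 1) - (T - Q * e) ≡ T * (N - + 1)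
  regroup = solve-∀

2^[3+m]∣w[j+2k]-w[j]⇒2^m∣k : ∀ {Q} m j k → + (2 ^ (3 ℕ.+ m)) ∣ₛ w Q (j ℕ.+ 2 ℕ.* k) - w Q j → 2 ^ m ∣ℕ k
2^[3+m]∣w[j+2k]-w[j]⇒2^m∣k {Q} m j k h =
  2^[3+k]∣9^d-1⇒2^k∣d m k (2^k∣m*n⇒2^k∣n (3 ℕ.+ m) {(+ 3) ^ℤ j} (∣m-1⇒∣m^k-1 (+ 3) j ∣-refl)
    (subst (_ ∣ₛ_) (w[j+2k]-w[j]≡3^j[9^k-1] Q j k) h))

8∣w[1+j]-w[j]-4[-1]^j : ∀ {Q} j → + 4 ∣ₛ Q - + 1 → + 8 ∣ₛ w Q (suc j) - w Q j - + 4 * neg1^ j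
8∣w[1+j]-w[j]-4[-1]^j {Q} j 4∣Q-1 = subst (+ 8 ∣ₛ_) (sym (regroup ((+ 3) ^ℤ j) Q (neg1^ j)))
  (∣m∣n⇒∣m+n (*-monoʳ-∣ (+ 2) (∣m-n⇒∣m^k-n^k (+ 3) (- + 1) j ∣-refl))
             (∣m⇒∣m*n (neg1^ j) (*-monoʳ-∣ (+ 2) 4∣Q-1)))
  where
  regroup : ∀ T Q e → (+ 3 * T - Q * (- + 1 * e)) - (T - Q * e) - + 4 * e
                      ≡ + 2 * (T - e) + + 2 * (Q - + 1) * e
  regroup = solve-∀

∣[-1]^k∣≡1 : ∀ k → ∣ neg1^ k ∣ ≡ 1
∣[-1]^k∣≡1 zero    = refl
∣[-1]^k∣≡1 (suc k) = trans (ℤP.abs-* (- + 1) (neg1^ k)) (trans (ℕP.*-identityˡ _) (∣[-1]^k∣≡1 k))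

8∤4[-1]^k : ∀ k → ¬ + 8 ∣ₛ + 4 * neg1^ k
8∤4[-1]^k k 8∣4e = 2n∤n 4 (∣ᵤ⇒∣ (subst (8 ∣ℕ_) ∣4e∣≡4 (∣⇒∣ᵤ 8∣4e)))
  where
  ∣4e∣≡4 : ∣ + 4 * neg1^ k ∣ ≡ 4
  ∣4e∣≡4 = trans (ℤP.abs-* (+ 4) (neg1^ k)) (cong (4 ℕ.*_) (∣[-1]^k∣≡1 k))

8∤w[j+1+2k]-w[j] : ∀ {Q} j k → + 4 ∣ₛ Q - + 1 → ¬ + 8 ∣ₛ w Q (j ℕ.+ suc (2 ℕ.* k)) - w Q j
8∤w[j+1+2k]-w[j] {Q} j k 4∣Q-1 8∣gap =
  8∤4[-1]^k j (subst (+ 8 ∣ₛ_) (regroup (w Q (suc j ℕ.+ 2 ℕ.* k)) (w Q (suc j)) (w Q j) (neg1^ j))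
    (∣m∣n⇒∣m-n (∣m∣n⇒∣m-n 8∣gap′ 8∣even-gap) (8∣w[1+j]-w[j]-4[-1]^j {Q} j 4∣Q-1)))
  where
  8∣gap′ : + 8 ∣ₛ w Q (suc j ℕ.+ 2 ℕ.* k) - w Q j
  8∣gap′ = subst (λ i → + 8 ∣ₛ w Q i - w Q j) (ℕP.+-suc j (2 ℕ.* k)) 8∣gap
  8∣even-gap : + 8 ∣ₛ w Q (suc j ℕ.+ 2 ℕ.* k) - w Q (suc j)
  8∣even-gap = subst (_ ∣ₛ_) (sym (w[j+2k]-w[j]≡3^j[9^k-1] Q (suc j) k))
                 (∣n⇒∣m*n ((+ 3) ^ℤ suc j) (∣m-1⇒∣m^k-1 (+ 9) k ∣-refl))
  regroup : ∀ W₂ W₁ W₀ e → (W₂ - W₀) - (W₂ - W₁) - (W₁ - W₀ - + 4 * e) ≡ + 4 * e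
  regroup = solve-∀

w-injective-≤ : ∀ {Q} m {i j} → + 4 ∣ₛ Q - + 1 → 1 ≤ j → j ≤ i → i ≤ 2 ^ suc m →
                + (2 ^ (3 ℕ.+ m)) ∣ₛ w Q i - w Q j → i ≡ j
w-injective-≤ {Q} m {j = j} 4∣Q-1 1≤j j≤i i≤2^[1+m] h with ℕP.m≤n⇒∃[o]m+o≡n j≤i
... | d , refl with parity d
...   | odd k  = contradiction (∣-trans (2^m∣2^[m+n] 3 m) h) (8∤w[j+1+2k]-w[j] {Q} j k 4∣Q-1)
...   | even k = trans (cong (λ k → j ℕ.+ 2 ℕ.* k) k≡0) (ℕP.+-identityʳ j)
  where
  k<2^m : k < 2 ^ m
  k<2^m = ℕP.*-cancelˡ-< 2 k (2 ^ m) (ℕP.<-≤-trans (ℕP.m<n+m (2 ℕ.* k) 1≤j) i≤2^[1+m])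
  k≡0 : k ≡ 0
  k≡0 = m∣n∧n<m⇒n≡0 (2^[3+m]∣w[j+2k]-w[j]⇒2^m∣k {Q} m j k h) k<2^m

w-injective : ∀ {Q} m {i j} → + 4 ∣ₛ Q - + 1 → 1 ≤ i → 1 ≤ j → i ≤ 2 ^ suc m → j ≤ 2 ^ suc m →
              + (2 ^ (3 ℕ.+ m)) ∣ₛ w Q i - w Q j → i ≡ j
w-injective {Q} m {i} {j} 4∣Q-1 1≤i 1≤j i≤2^[1+m] j≤2^[1+m] h with ℕP.≤-total j i
... | inj₁ j≤i = w-injective-≤ {Q} m 4∣Q-1 1≤j j≤i i≤2^[1+m] h
... | inj₂ i≤j = sym (w-injective-≤ {Q} m 4∣Q-1 1≤i i≤j j≤2^[1+m]
                        (subst (_ ∣ₛ_) (flip (w Q i) (w Q j)) (∣m⇒∣-m h)))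
  where
  flip : ∀ a b → - (a - b) ≡ b - a
  flip = solve-∀

lemma4 : (q n m : ℕ) → Prime q → 5 ≤ q → 2 ≤ n → n ≤ 2 ^ m →
         (i j : ℕ) → 1 ≤ i → i ≤ n → 1 ≤ j → j ≤ n →
         (+ (2 ^ m)) ∣ (u q i - u q j) → i ≡ j
lemma4 q n zero    _       _   2≤n n≤1     _ _ _   _   _   _   _ =
  contradiction (ℕP.≤-trans 2≤n n≤1) λ { (s≤s ()) }
lemma4 q n (suc m) q-prime 5≤q _   n≤2^m i j 1≤i i≤n 1≤j j≤n 2^m∣ui-uj =
  w-injective {qStar q} m 4∣Q-1 1≤i 1≤j (ℕP.≤-trans i≤n n≤2^m) (ℕP.≤-trans j≤n n≤2^m)
    (2^m∣u-u⇒2^[2+m]∣w-w {q} (suc m) i j 4∣Q-1 2^m∣ui-uj)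
  where
  4∣Q-1 : + 4 ∣ₛ qStar q - + 1
  4∣Q-1 = 4∣q⋆-1 q-prime (ℕP.>⇒≢ (ℕP.≤-trans (s≤s (s≤s (s≤s z≤n))) 5≤q))
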